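{- Let $H=(V,E)$ be a hypergraph, let $H'$ be its intersection-closure, and let $d$ be a positive integer. The following are equivalent: (i) $H$ is $(d+1)$-semi-ladder-free; (ii) $H'$ is $(d+1)$-ladder-free; (iii) $L(H')\le d+1$.
   Context: A hypergraph is a pair $H=(V,E)$ with $V$ a finite set and $E\subseteq 2^V$. For an integer $d\ge1$, a $d$-semi-ladder in $H$ is a pair $(W,F)$ with $W=\{w_0,\ldots,w_d\}\subseteq V$, $F=\{f_0,\ldots,f_d\}\subseteq E$, such that $w_i\notin f_i$ for each $i\in[0;d]$ and $w_i\in f_j$ whenever $0\le i<j\le d$. A $d$-ladder is such a pair $(W,F)$ with $w_i\in f_j\iff i<j$ for all $i,j\in[0;d]$. $H$ is $d$-semi-ladder-free (resp. $d$-ladder-free) if it has no $d$-semi-ladder (resp. $d$-ladder). $H$ is intersection-closed if $V\in E$ and $e\cap f\in E$ for all $e,f\in E$; the intersection-closure of $H$ is the minimal intersection-closed hypergraph $H'=(V,E')$ with $E\subseteq E'$. For $e\in E$, an $e$-chain is a sequence $e_0\subsetneq e_1\subsetneq\cdots\subsetneq e_l$ of edges with $e_l=e$, of length $l$; $l_H(e)$ is the maximum length of an $e$-chain in $H$, and $L(H)=\max_{e\in E}l_H(e)$. -}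

module Defs where

open import Data.Nat using (ℕ; suc; _≤_)
open import Data.Fin using (Fin; inject₁) renaming (_<_ to _<ᶠ_; suc to fsuc)
open import Data.Fin.Subset using (Subset; _∈_; _∉_; _⊂_; _∩_; ⊤)
open import Data.List using (List)
import Data.List.Membership.Propositional as LM
open import Data.Product using (_×_; Σ)
open import Relation.Nullary using (¬_)
open import Function.Bundles using (_⇔_)

record Hypergraph : Set where
  constructor hypergraph
  field
    n     : ℕ
    edges : List (Subset n)

open Hypergraph public

Family : ℕ → Set₁
Family n = Subset n → Set

edgeFamily : (H : Hypergraph) → Family (n H)
edgeFamily H e = e LM.∈ edges H

data Closure {n : ℕ} (E : Family n) : Family n where
  base  : ∀ {e} → E e → Closure E e
  full  : Closure E ⊤
  inter : ∀ {e f} → Closure E e → Closure E f → Closure E (e ∩ f)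

-- d-semi-ladder (indices 0..d, i.e. Fin (suc d))
SemiLadder : {n : ℕ} → Family n → ℕ → Set
SemiLadder {n} E d =
  Σ (Fin (suc d) → Fin n) λ w →
  Σ (Fin (suc d) → Subset n) λ f →
    (∀ i → E (f i)) ×
    (∀ i → w i ∉ f i) ×
    (∀ i j → i <ᶠ j → w i ∈ f j)

Ladder : {n : ℕ} → Family n → ℕ → Set
Ladder {n} E d =
  Σ (Fin (suc d) → Fin n) λ w →
  Σ (Fin (suc d) → Subset n) λ f →
    (∀ i → E (f i)) ×
    (∀ i j → (w i ∈ f j) ⇔ (i <ᶠ j))

SemiLadderFree : {n : ℕ} → Family n → ℕ → Set
SemiLadderFree E d = ¬ SemiLadder E d

LadderFree : {n : ℕ} → Family n → ℕ → Set
LadderFree E d = ¬ Ladder E d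

Chain : {n : ℕ} → Family n → ℕ → Set
Chain {n} E l =
  Σ (Fin (suc l) → Subset n) λ e →
    (∀ i → E (e i)) ×
    (∀ (i : Fin l) → e (inject₁ i) ⊂ e (fsuc i))

-- L(H) ≤ k : every chain of edges (ending in any edge) has length ≤ k,
-- i.e. the maximum l_H(e) over e ∈ E is at most k.
L≤ : {n : ℕ} → Family n → ℕ → Set
L≤ E k = ∀ l → Chain E l → l ≤ k

-- A semi-ladder (w, f) in H becomes a ladder in H' on replacing each f j by
-- the suffix intersection ⋂_{k ≥ j} f k; conversely every edge of H' missing
-- a vertex lies in an edge of H missing it, which turns a ladder of H' back
-- into a semi-ladder of H. The suffix intersections of a d-ladder, together
-- with the empty intersection V, form a chain of length d + 1, and a chain of
-- length d + 1 yields a d-ladder by choosing one new vertex per strict step.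
module Submission where

open import Defs
open import Data.Nat using (ℕ; zero; suc; _≤_; _≤′_; ≤′-reflexive; ≤′-step; z≤n; s≤s; _≤?_)
open import Data.Nat.Properties using (≤-refl; ≤-trans; n≤1+n; ≰⇒>; n≮n; 1+n≰n; ≤⇒≤′)
open import Data.Fin using (Fin; toℕ; inject₁) renaming (zero to fzero; suc to fsuc; _≤_ to _≤ᶠ_)
open import Data.Fin.Properties using (toℕ-inject₁)
open import Data.Fin.Subset using (Subset; _∈_; _∉_; _⊆_; _⊂_; _∩_; ⊤)
open import Data.Fin.Subset.Properties using (x∈p∩q⁺; x∈p∩q⁻; ∈⊤; _∈?_)
open import Data.Product using (_×_; _,_; proj₁; proj₂; Σ)
open import Data.Empty using (⊥-elim)
open import Function.Bundles using (_⇔_; mk⇔; module Equivalence)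
open import Relation.Nullary using (yes; no)
open import Relation.Binary.PropositionalEquality using (refl; sym; subst; subst₂)

open Equivalence using (to; from)

private
  variable
    N m l d : ℕ
    E : Family N

-- ⋂≥ f k is the intersection of all f j with k ≤ j, hence ⊤ once k ≥ m.
⋂≥ : (Fin m → Subset N) → ℕ → Subset N
⋂≥ {zero}  f k       = ⊤
⋂≥ {suc m} f zero    = f fzero ∩ ⋂≥ (λ j → f (fsuc j)) zero
⋂≥ {suc m} f (suc k) = ⋂≥ (λ j → f (fsuc j)) k

∈⋂≥⁺ : (f : Fin m → Subset N) (k : ℕ) {x : Fin N} →
       (∀ j → k ≤ toℕ j → x ∈ f j) → x ∈ ⋂≥ f k
∈⋂≥⁺ {zero}  f k       h = ∈⊤
∈⋂≥⁺ {suc m} f zero    h = x∈p∩q⁺ (h fzero z≤n , ∈⋂≥⁺ _ zero λ j _ → h (fsuc j) z≤n)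
∈⋂≥⁺ {suc m} f (suc k) h = ∈⋂≥⁺ _ k λ j k≤j → h (fsuc j) (s≤s k≤j)

∈⋂≥⁻ : (f : Fin m → Subset N) (k : ℕ) {x : Fin N} →
       x ∈ ⋂≥ f k → ∀ j → k ≤ toℕ j → x ∈ f j
∈⋂≥⁻ {suc m} f zero    x∈ fzero    _         = proj₁ (x∈p∩q⁻ (f fzero) _ x∈)
∈⋂≥⁻ {suc m} f zero    x∈ (fsuc j) _         = ∈⋂≥⁻ _ zero (proj₂ (x∈p∩q⁻ (f fzero) _ x∈)) j z≤n
∈⋂≥⁻ {suc m} f (suc k) x∈ (fsuc j) (s≤s k≤j) = ∈⋂≥⁻ _ k x∈ j k≤j

⋂≥-Closure : (f : Fin m → Subset N) (k : ℕ) →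
             (∀ j → Closure E (f j)) → Closure E (⋂≥ f k)
⋂≥-Closure {zero}  f k       h = full
⋂≥-Closure {suc m} f zero    h = inter (h fzero) (⋂≥-Closure _ zero λ j → h (fsuc j))
⋂≥-Closure {suc m} f (suc k) h = ⋂≥-Closure _ k λ j → h (fsuc j)

⋂≥-⊂-suc : (f : Fin m → Subset N) (k : ℕ) {x : Fin N} →
           x ∈ ⋂≥ f (suc k) → x ∉ ⋂≥ f k → ⋂≥ f k ⊂ ⋂≥ f (suc k)
⋂≥-⊂-suc f k {x} x∈ x∉ =
  (λ y∈ → ∈⋂≥⁺ f (suc k) λ j k<j → ∈⋂≥⁻ f k y∈ j (≤-trans (n≤1+n k) k<j)) , x , x∈ , x∉

closure-avoiding-edge : {f : Subset N} {x : Fin N} → Closure E f → x ∉ f →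
                        Σ (Subset N) λ e → E e × f ⊆ e × x ∉ e
closure-avoiding-edge (base {e} Ee) x∉ = e , Ee , (λ x∈ → x∈) , x∉
closure-avoiding-edge full          x∉ = ⊥-elim (x∉ ∈⊤)
closure-avoiding-edge {x = x} (inter {e} {f} Ce Cf) x∉e∩f with x ∈? e
... | no x∉e =
  let e′ , Ee′ , e⊆e′ , x∉e′ = closure-avoiding-edge Ce x∉e
  in  e′ , Ee′ , (λ y∈ → e⊆e′ (proj₁ (x∈p∩q⁻ e f y∈))) , x∉e′
... | yes x∈e =
  let f′ , Ef′ , f⊆f′ , x∉f′ = closure-avoiding-edge Cf λ x∈f → x∉e∩f (x∈p∩q⁺ (x∈e , x∈f))
  in  f′ , Ef′ , (λ y∈ → f⊆f′ (proj₂ (x∈p∩q⁻ e f y∈))) , x∉f′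

semiLadder⇒closureLadder : SemiLadder E d → Ladder (Closure E) d
semiLadder⇒closureLadder (w , f , Ef , w∉f , w∈f) =
  w , (λ j → ⋂≥ f (toℕ j)) , (λ j → ⋂≥-Closure f (toℕ j) λ k → base (Ef k)) ,
  λ i j → mk⇔ (λ w∈g → ≰⇒> λ j≤i → w∉f i (∈⋂≥⁻ f (toℕ j) w∈g i j≤i))
              (λ i<j → ∈⋂≥⁺ f (toℕ j) λ k j≤k → w∈f i k (≤-trans i<j j≤k))

closureLadder⇒semiLadder : Ladder (Closure E) d → SemiLadder E d
closureLadder⇒semiLadder (w , f , Cf , w∈f⇔) =
  w , (λ i → proj₁ (enlarge i)) , (λ i → proj₁ (proj₂ (enlarge i))) ,
  (λ i → proj₂ (proj₂ (proj₂ (enlarge i)))) ,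
  λ i j i<j → proj₁ (proj₂ (proj₂ (enlarge j))) (from (w∈f⇔ i j) i<j)
  where
    enlarge : ∀ i → Σ (Subset _) λ e → _ × f i ⊆ e × w i ∉ e
    enlarge i = closure-avoiding-edge (Cf i) λ w∈ → n≮n _ (to (w∈f⇔ i i) w∈)

chain-⊆ : (e : Fin (suc l) → Subset N) → (∀ i → e (inject₁ i) ⊆ e (fsuc i)) →
          ∀ {i j} → i ≤ᶠ j → e i ⊆ e j
chain-⊆ e step {fzero}  {fzero}  _         = λ x∈ → x∈
chain-⊆ {suc l} e step {fzero} {fsuc j} _ =
  λ x∈ → chain-⊆ (λ i → e (fsuc i)) (λ i → step (fsuc i)) {fzero} {j} z≤n (step fzero x∈)
chain-⊆ {suc l} e step {fsuc i} {fsuc j} (s≤s i≤j) =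
  chain-⊆ (λ i → e (fsuc i)) (λ i → step (fsuc i)) i≤j

Chain-dropLast : Chain E (suc l) → Chain E l
Chain-dropLast (e , Ee , e⊂) = (λ i → e (inject₁ i)) , (λ i → Ee (inject₁ i)) , λ i → e⊂ (inject₁ i)

Chain-shorten : m ≤′ l → Chain E l → Chain E m
Chain-shorten (≤′-reflexive refl)     c = c
Chain-shorten {E = E} (≤′-step m≤l) c = Chain-shorten {E = E} m≤l (Chain-dropLast {E = E} c)

chain⇒ladder : Chain E (suc d) → Ladder E d
chain⇒ladder {d = d} (e , Ee , e⊂) =
  w , (λ j → e (inject₁ j)) , (λ j → Ee (inject₁ j)) ,
  λ i j → mk⇔ (λ w∈ → ≰⇒> λ j≤i → w∉ i (⊆-inject₁ j≤i w∈))
              (λ i<j → chain-⊆ e e⊆ (subst (suc (toℕ i) ≤_) (sym (toℕ-inject₁ j)) i<j) (w∈ i))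
  where
    e⊆ : ∀ i → e (inject₁ i) ⊆ e (fsuc i)
    e⊆ i = proj₁ (e⊂ i)
    w : Fin (suc d) → Fin _
    w i = proj₁ (proj₂ (e⊂ i))
    w∈ : ∀ i → w i ∈ e (fsuc i)
    w∈ i = proj₁ (proj₂ (proj₂ (e⊂ i)))
    w∉ : ∀ i → w i ∉ e (inject₁ i)
    w∉ i = proj₂ (proj₂ (proj₂ (e⊂ i)))
    ⊆-inject₁ : ∀ {i j} → i ≤ᶠ j → e (inject₁ i) ⊆ e (inject₁ j)
    ⊆-inject₁ {i} {j} i≤j = chain-⊆ e e⊆
      (subst₂ _≤_ (sym (toℕ-inject₁ i)) (sym (toℕ-inject₁ j)) i≤j)

closureLadder⇒chain : Ladder (Closure E) d → Chain (Closure E) (suc d)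
closureLadder⇒chain (w , f , Cf , w∈f⇔) =
  (λ i → ⋂≥ f (toℕ i)) , (λ i → ⋂≥-Closure f (toℕ i) Cf) ,
  λ i → subst (λ k → ⋂≥ f k ⊂ ⋂≥ f (suc (toℕ i))) (sym (toℕ-inject₁ i))
          (⋂≥-⊂-suc f (toℕ i)
            (∈⋂≥⁺ f (suc (toℕ i)) λ j i<j → from (w∈f⇔ i j) i<j)
            (λ w∈ → n≮n _ (to (w∈f⇔ i i) (∈⋂≥⁻ f (toℕ i) w∈ i ≤-refl))))

ladderFree⇒L≤ : LadderFree E d → L≤ E d
ladderFree⇒L≤ {E = E} {d = d} free l c with l ≤? d
... | yes l≤d = l≤d
... | no  l≰d = ⊥-elim (free (chain⇒ladder {E = E} (Chain-shorten {E = E} (≤⇒≤′ (≰⇒> l≰d)) c)))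

L≤⇒closureLadderFree : L≤ (Closure E) d → LadderFree (Closure E) d
L≤⇒closureLadderFree {d = d} L≤d ladder = 1+n≰n (L≤d (suc d) (closureLadder⇒chain ladder))

theorem1 : (H : Hypergraph) (d : ℕ) → 1 ≤ d →
    (SemiLadderFree (edgeFamily H) (suc d) ⇔ LadderFree (Closure (edgeFamily H)) (suc d))
    × (LadderFree (Closure (edgeFamily H)) (suc d) ⇔ L≤ (Closure (edgeFamily H)) (suc d))
theorem1 H d _ =
  mk⇔ (λ free ladder → free (closureLadder⇒semiLadder ladder))
      (λ free semi → free (semiLadder⇒closureLadder semi)) ,
  mk⇔ (ladderFree⇒L≤ {E = Closure (edgeFamily H)}) L≤⇒closureLadderFree
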